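{- Let $G=(V,E)$ be a graph with $V=\{1,\dots,n\}$ and $\mathcal{T}=\mathcal{T}(G)$ its individualization-refinement search tree. The quotient tree $\mathcal{T}/\mathrm{Aut}(G)$ has $|L(\mathcal{T}/\mathrm{Aut}(G))|=\frac{|L(\mathcal{T})|}{|\mathrm{Aut}(G)|}$ leaves.
   Context: A coloring is a surjection $V\to\{1,\dots,k\}$, discrete if $k=n$. For $\varphi\in S_n$, $G^\varphi=(\varphi(V),\varphi(E))$, and $\varphi$ acts entrywise on vertex sequences. A refinement $\mathrm{Ref}(G,\nu)$ (for $\nu$ a finite vertex sequence) is a coloring, isomorphism invariant ($\mathrm{Ref}(G^\varphi,\nu^\varphi)=\mathrm{Ref}(G,\nu)^\varphi$) with every vertex of $\nu$ a singleton cell. A cell selector $\mathrm{Sel}$ is isomorphism invariant, returns $\emptyset$ on discrete colorings and otherwise a cell of size $>1$. The search tree $\mathcal{T}(G)$ has root the empty sequence and the children of $\nu$ are $\nu.v$ for $v\in\mathrm{Sel}(G,\mathrm{Ref}(G,\nu))$; leaves are nodes whose coloring is discrete; $\mathrm{Aut}(G)$ acts on the nodes of $\mathcal{T}(G)$ entrywise. $L(\cdot)$ denotes the set of leaves. For a group $\Gamma\le\mathrm{Aut}(G)$, the quotient $\mathcal{T}/\Gamma$ is the graph whose vertices are the orbits of nodes of $\mathcal{T}$ under $\Gamma$, two orbits being adjacent if they contain adjacent nodes; its leaves are the orbits of leaves of $\mathcal{T}$. -}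

module Defs where

open import Data.Nat using (ℕ; _<_; _*_)
open import Data.Nat.Properties using ()
open import Data.Bool using (Bool; true; false; if_then_else_)
open import Data.Fin using (Fin)
open import Data.Vec using (Vec; lookup; tabulate)
open import Data.List using (List; []; _∷_; _++_; map; length)
open import Data.List.Membership.Propositional using () renaming (_∈_ to _∈ᴸ_)
open import Data.List.Relation.Unary.All using (All)
open import Data.List.Relation.Unary.Any using (Any)
open import Data.List.Relation.Unary.AllPairs using (AllPairs)
open import Data.Fin.Subset using (Subset; Side; inside; outside; ∣_∣; _∈_) renaming (⊥ to ∅)
open import Data.Fin.Permutation using (Permutation′; _⟨$⟩ʳ_; _⟨$⟩ˡ_)
open import Data.Product using (Σ; ∃; ∃-syntax; _×_)
open import Relation.Nullary using (¬_; does)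
open import Relation.Binary.PropositionalEquality using (_≡_)
import Data.Nat as ℕ

-- Graphs on V = Fin n (vertex i ↔ i+1 in the paper), as adjacency matrices.

AdjMatrix : ℕ → Set
AdjMatrix n = Vec (Vec Bool n) n

adj : ∀ {n} → AdjMatrix n → Fin n → Fin n → Bool
adj G u v = lookup (lookup G u) v

IsGraph : ∀ {n} → AdjMatrix n → Set
IsGraph {n} G = (∀ u v → adj G u v ≡ adj G v u) × (∀ u → adj G u u ≡ false)

-- G^φ = (φ(V), φ(E)):  {φ u, φ v} ∈ φ(E)  iff  {u,v} ∈ E
_^ᴳ_ : ∀ {n} → AdjMatrix n → Permutation′ n → AdjMatrix n
G ^ᴳ φ = tabulate λ x → tabulate λ y → adj G (φ ⟨$⟩ˡ x) (φ ⟨$⟩ˡ y)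

_^ˢ_ : ∀ {n} → List (Fin n) → Permutation′ n → List (Fin n)
ν ^ˢ φ = map (φ ⟨$⟩ʳ_) ν

-- Colorings: a coloring is a vector of colors; colors are 0,…,k-1
-- (instead of 1,…,k).  c is a coloring with k colors iff c : V → {0..k-1}
-- is surjective.

Col : ℕ → Set
Col n = Vec ℕ n

IsColoringWith : ∀ {n} → ℕ → Col n → Set
IsColoringWith {n} k c = (∀ v → lookup c v < k) × (∀ j → j < k → ∃[ v ] lookup c v ≡ j)

IsColoring : ∀ {n} → Col n → Set
IsColoring {n} c = ∃[ k ] IsColoringWith k c

Discrete : ∀ {n} → Col n → Set
Discrete {n} c = IsColoringWith n c

_^ᶜ_ : ∀ {n} → Col n → Permutation′ n → Col n
c ^ᶜ φ = tabulate λ x → lookup c (φ ⟨$⟩ˡ x)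

_^ᵛ_ : ∀ {n} → Subset n → Permutation′ n → Subset n
S ^ᵛ φ = tabulate λ x → lookup S (φ ⟨$⟩ˡ x)

cell : ∀ {n} → Col n → ℕ → Subset n
cell c j = tabulate λ v → if does (lookup c v ℕ.≟ j) then inside else outside

record Refinement (n : ℕ) : Set where
  field
    Ref : AdjMatrix n → List (Fin n) → Col n
    isColoring : ∀ G ν → IsGraph G → IsColoring (Ref G ν)
    invariant : ∀ G ν (φ : Permutation′ n) → IsGraph G →
                Ref (G ^ᴳ φ) (ν ^ˢ φ) ≡ (Ref G ν) ^ᶜ φ
    individualized : ∀ G ν → IsGraph G → ∀ v → v ∈ᴸ ν →
                     ∀ w → lookup (Ref G ν) w ≡ lookup (Ref G ν) v → w ≡ v

record CellSelector (n : ℕ) : Set where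
  field
    Sel : AdjMatrix n → Col n → Subset n
    invariant : ∀ G π (φ : Permutation′ n) → IsGraph G → IsColoring π →
                Sel (G ^ᴳ φ) (π ^ᶜ φ) ≡ (Sel G π) ^ᵛ φ
    onDiscrete : ∀ G π → IsGraph G → Discrete π → Sel G π ≡ ∅
    onNonDiscrete : ∀ G π → IsGraph G → IsColoring π → ¬ Discrete π →
                    ∃[ j ] (Sel G π ≡ cell π j × 1 < ∣ cell π j ∣)

module SearchTree {n : ℕ} (R : Refinement n) (S : CellSelector n) (G : AdjMatrix n) where
  open Refinement R
  open CellSelector S

  data Node : List (Fin n) → Set where
    root  : Node []
    child : ∀ {ν} v → Node ν → v ∈ Sel G (Ref G ν) → Node (ν ++ (v ∷ []))

  Leaf : List (Fin n) → Set
  Leaf ν = Node ν × Discrete (Ref G ν)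

IsAut : ∀ {n} → AdjMatrix n → Permutation′ n → Set
IsAut G φ = G ^ᴳ φ ≡ G

_≈ᵖ_ : ∀ {n} → Permutation′ n → Permutation′ n → Set
φ ≈ᵖ ψ = ∀ i → φ ⟨$⟩ʳ i ≡ ψ ⟨$⟩ʳ i

-- With ≈ being equality
-- this says |P| = N; otherwise it says P/≈ has N elements.

CountMod : {A : Set} → (A → Set) → (A → A → Set) → ℕ → Set
CountMod {A} P _≈_ N =
  Σ (List A) λ xs → length xs ≡ N × All P xs × AllPairs (λ x y → ¬ (x ≈ y)) xs
                  × (∀ x → P x → Any (λ y → x ≈ y) xs)

SameOrbit : ∀ {n} → AdjMatrix n → List (Fin n) → List (Fin n) → Set
SameOrbit G ν ν' = ∃[ φ ] (IsAut G φ × ν ^ˢ φ ≡ ν')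

-- Aut(G) acts on the leaves of T(G) (refinement and cell selector are
-- isomorphism invariant), and the action is free: a leaf ν has a discrete
-- coloring π, and ν^φ = ν^ψ forces π ∘ φ⁻¹ = π ∘ ψ⁻¹, hence φ = ψ because
-- π is injective.  So every orbit of leaves has exactly |Aut(G)| elements,
-- and (orbit representative, automorphism) ↦ leaf is a bijection.
module Submission where

open import Defs
open import Data.Nat as ℕ using (ℕ; suc; _*_)
open import Data.Nat.Properties using (≤-antisym; <-irrefl)
open import Data.Fin using (Fin; toℕ; punchOut)
open import Data.Fin.Properties
  using (toℕ<n; toℕ-injective; any?; _≟_; injective⇒≤; punchOut-injective; *↔×)
open import Data.Fin.Permutation using (Permutation′; _⟨$⟩ʳ_; _⟨$⟩ˡ_; inverseˡ; inverseʳ; flip; _∘ₚ_)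
open import Data.Fin.Subset using (Subset; _∈_)
open import Data.List using (List; []; _∷_; lookup)
open import Data.List.Properties using (map-∘; map-cong; map-id; map-++)
open import Data.List.Membership.Propositional.Properties using (∈-lookup)
import Data.List.Relation.Unary.All as All
import Data.List.Relation.Unary.Any as Any
open import Data.List.Relation.Unary.Any.Properties using (lookup-index)
open import Data.List.Relation.Unary.AllPairs using (AllPairs; _∷_)
open import Data.Product using (∃-syntax; _×_; _,_; proj₁; proj₂)
open import Data.Vec as Vec using (tabulate)
open import Data.Vec.Properties using (lookup∘tabulate; tabulate-cong; tabulate∘lookup; lookup⇒[]=; []=⇒lookup)
open import Function using (_∘_)
open import Function.Bundles using (Injection)
open import Function.Definitions using (Injective; StrictlySurjective)
open import Function.Properties.Inverse using (↔⇒↣; ↔-sym)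
open import Relation.Binary.Definitions using (Symmetric)
open import Relation.Binary.PropositionalEquality
open import Relation.Nullary using (¬_; yes; no)
open import Data.Empty using (⊥-elim)

injective⇒strictlySurjective : ∀ {n} {f : Fin n → Fin n} →
                               Injective _≡_ _≡_ f → StrictlySurjective _≡_ f
injective⇒strictlySurjective {suc m} {f} f-inj y with any? (λ x → f x ≟ y)
... | yes hit = hit
... | no miss = ⊥-elim (<-irrefl refl (injective⇒≤ {f = f′} f′-inj))
  where
  y≢f : ∀ x → y ≢ f x
  y≢f x y≡fx = miss (x , sym y≡fx)
  -- f misses y, so it factors injectively through Fin m ≅ Fin (suc m) ∖ {y}.
  f′ : Fin (suc m) → Fin m
  f′ x = punchOut (y≢f x)
  f′-inj : Injective _≡_ _≡_ f′
  f′-inj eq = f-inj (punchOut-injective (y≢f _) (y≢f _) eq)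

*≡-from-injections : ∀ {m n k} {f : Fin m × Fin n → Fin k} {g : Fin k → Fin m × Fin n} →
                     Injective _≡_ _≡_ f → Injective _≡_ _≡_ g → m * n ≡ k
*≡-from-injections {m} {n} f-inj g-inj = ≤-antisym
  (injective⇒≤ (Injection.injective (↔⇒↣ (*↔× {m} {n})) ∘ f-inj))
  (injective⇒≤ (g-inj ∘ Injection.injective (↔⇒↣ (↔-sym (*↔× {m} {n})))))

distinct⇒lookup-injective : ∀ {A : Set} {_≈_ : A → A → Set} → Symmetric _≈_ →
                            ∀ {xs} → AllPairs (λ x y → ¬ x ≈ y) xs →
                            ∀ i j → lookup xs i ≈ lookup xs j → i ≡ j
distinct⇒lookup-injective sym (_ ∷ _) Fin.zero Fin.zero _ = refl
distinct⇒lookup-injective sym (x≉ ∷ _) Fin.zero (Fin.suc j) x≈ =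
  ⊥-elim (All.lookup x≉ (∈-lookup j) x≈)
distinct⇒lookup-injective sym (x≉ ∷ _) (Fin.suc i) Fin.zero ≈x =
  ⊥-elim (All.lookup x≉ (∈-lookup i) (sym ≈x))
distinct⇒lookup-injective sym (_ ∷ distinct) (Fin.suc i) (Fin.suc j) eq =
  cong Fin.suc (distinct⇒lookup-injective sym distinct i j eq)

record Transversal {A : Set} (P : A → Set) (_≈_ : A → A → Set) (N : ℕ) : Set where
  field
    rep           : Fin N → A
    rep-P         : ∀ i → P (rep i)
    rep-injective : ∀ {i j} → rep i ≈ rep j → i ≡ j
    class         : ∀ {x} → P x → Fin N
    ≈-rep-class   : ∀ {x} (px : P x) → x ≈ rep (class px)

countMod⇒transversal : ∀ {A : Set} {P : A → Set} {_≈_ : A → A → Set} {N} →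
                       Symmetric _≈_ → CountMod P _≈_ N → Transversal P _≈_ N
countMod⇒transversal sym (xs , refl , all-P , distinct , covers) = record
  { rep           = lookup xs
  ; rep-P         = λ i → All.lookup all-P (∈-lookup i)
  ; rep-injective = distinct⇒lookup-injective sym distinct _ _
  ; class         = λ px → Any.index (covers _ px)
  ; ≈-rep-class   = λ px → lookup-index (covers _ px)
  }

module FreeAction
  {A Π : Set} (P : A → Set) (Γ : Π → Set) (_≈_ : Π → Π → Set)
  (_·_ : A → Π → A) (_∘′_ : Π → Π → Π) (_⁻¹ : Π → Π)
  (≈-sym : Symmetric _≈_)
  (·-cong : ∀ x {φ ψ} → φ ≈ ψ → x · φ ≡ x · ψ)
  (·-∘ : ∀ x φ ψ → x · (φ ∘′ ψ) ≡ (x · φ) · ψ)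
  (·-⁻¹ : ∀ x φ → (x · φ) · (φ ⁻¹) ≡ x)
  (Γ-∘ : ∀ φ ψ → Γ φ → Γ ψ → Γ (φ ∘′ ψ))
  (Γ-⁻¹ : ∀ φ → Γ φ → Γ (φ ⁻¹))
  (P-· : ∀ {x} φ → P x → Γ φ → P (x · φ))
  (free : ∀ {x} φ ψ → P x → Γ φ → Γ ψ → x · φ ≡ x · ψ → φ ≈ ψ)
  where

  Orbit : A → A → Set
  Orbit x y = ∃[ φ ] (Γ φ × x · φ ≡ y)

  Orbit-sym : Symmetric Orbit
  Orbit-sym {x} (φ , γφ , refl) = φ ⁻¹ , Γ-⁻¹ φ γφ , ·-⁻¹ x φ

  Orbit-from-common-image : ∀ {x y φ ψ} → Γ φ → Γ ψ → x · φ ≡ y · ψ → Orbit x y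
  Orbit-from-common-image {x} {y} {φ} {ψ} γφ γψ eq =
    φ ∘′ (ψ ⁻¹) , Γ-∘ φ (ψ ⁻¹) γφ (Γ-⁻¹ ψ γψ) , (begin
    x · (φ ∘′ (ψ ⁻¹))  ≡⟨ ·-∘ x φ (ψ ⁻¹) ⟩
    (x · φ) · (ψ ⁻¹)   ≡⟨ cong (_· (ψ ⁻¹)) eq ⟩
    (y · ψ) · (ψ ⁻¹)   ≡⟨ ·-⁻¹ y ψ ⟩
    y                  ∎)
    where open ≡-Reasoning

  |P/Γ|*|Γ|≡|P| : ∀ {NP NΓ NO} → CountMod P _≡_ NP → CountMod Γ _≈_ NΓ →
                   CountMod P Orbit NO → NO * NΓ ≡ NP
  |P/Γ|*|Γ|≡|P| {NP} {NΓ} {NO} countP countΓ countO =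
    *≡-from-injections translate-injective decompose-injective
    where
    module Elt = Transversal (countMod⇒transversal sym countP)
    module Grp = Transversal (countMod⇒transversal ≈-sym countΓ)
    module Orb = Transversal (countMod⇒transversal Orbit-sym countO)

    rep·rep : Fin NO × Fin NΓ → A
    rep·rep (i , j) = Orb.rep i · Grp.rep j

    rep·rep-injective : Injective _≡_ _≡_ rep·rep
    rep·rep-injective {i , j} {i′ , j′} eq
      with refl ← Orb.rep-injective (Orbit-from-common-image (Grp.rep-P j) (Grp.rep-P j′) eq) =
      cong (i ,_) (Grp.rep-injective
        (free (Grp.rep j) (Grp.rep j′) (Orb.rep-P i) (Grp.rep-P j) (Grp.rep-P j′) eq))

    translate : Fin NO × Fin NΓ → Fin NP
    translate (i , j) = Elt.class (P-· (Grp.rep j) (Orb.rep-P i) (Grp.rep-P j))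

    translate-injective : Injective _≡_ _≡_ translate
    translate-injective eq =
      rep·rep-injective (trans (Elt.≈-rep-class _) (trans (cong Elt.rep eq) (sym (Elt.≈-rep-class _))))

    decompose : Fin NP → Fin NO × Fin NΓ
    decompose k with Orb.≈-rep-class (Elt.rep-P k)
    ... | φ , γφ , _ = Orb.class (Elt.rep-P k) , Grp.class (Γ-⁻¹ φ γφ)

    rep·rep-decompose : ∀ k → rep·rep (decompose k) ≡ Elt.rep k
    rep·rep-decompose k with Orb.≈-rep-class (Elt.rep-P k)
    ... | φ , γφ , eq = begin
      Orb.rep i · Grp.rep (Grp.class (Γ-⁻¹ φ γφ))  ≡⟨ ·-cong (Orb.rep i) (Grp.≈-rep-class (Γ-⁻¹ φ γφ)) ⟨
      Orb.rep i · (φ ⁻¹)                           ≡⟨ cong (_· (φ ⁻¹)) eq ⟨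
      (Elt.rep k · φ) · (φ ⁻¹)                     ≡⟨ ·-⁻¹ (Elt.rep k) φ ⟩
      Elt.rep k                                    ∎
      where
      open ≡-Reasoning
      i = Orb.class (Elt.rep-P k)

    decompose-injective : Injective _≡_ _≡_ decompose
    decompose-injective {k} {k′} eq = Elt.rep-injective
      (trans (sym (rep·rep-decompose k)) (trans (cong rep·rep eq) (rep·rep-decompose k′)))

module _ {n : ℕ} where

  adj-^ᴳ : ∀ (G : AdjMatrix n) φ x y → adj (G ^ᴳ φ) x y ≡ adj G (φ ⟨$⟩ˡ x) (φ ⟨$⟩ˡ y)
  adj-^ᴳ G φ x y =
    trans (cong (λ row → Vec.lookup row y) (lookup∘tabulate _ x)) (lookup∘tabulate _ y)

  PreservesAdj : AdjMatrix n → (Fin n → Fin n) → Set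
  PreservesAdj G f = ∀ x y → adj G (f x) (f y) ≡ adj G x y

  IsAut⇒preserves-⟨$⟩ˡ : ∀ {G} φ → IsAut G φ → PreservesAdj G (φ ⟨$⟩ˡ_)
  IsAut⇒preserves-⟨$⟩ˡ {G} φ aut x y = trans (sym (adj-^ᴳ G φ x y)) (cong (λ H → adj H x y) aut)

  preserves-⟨$⟩ˡ⇒IsAut : ∀ {G} φ → PreservesAdj G (φ ⟨$⟩ˡ_) → IsAut G φ
  preserves-⟨$⟩ˡ⇒IsAut {G} φ preserves = begin
    G ^ᴳ φ                                  ≡⟨ tabulate-cong (λ x → tabulate-cong (preserves x)) ⟩
    tabulate (λ x → tabulate (adj G x))     ≡⟨ tabulate-cong (λ x → tabulate∘lookup (Vec.lookup G x)) ⟩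
    tabulate (Vec.lookup G)                 ≡⟨ tabulate∘lookup G ⟩
    G                                       ∎
    where open ≡-Reasoning

  IsAut-flip : ∀ {G} φ → IsAut G φ → IsAut G (flip φ)
  IsAut-flip {G} φ aut = preserves-⟨$⟩ˡ⇒IsAut (flip φ) λ x y →
    trans (sym (IsAut⇒preserves-⟨$⟩ˡ φ aut _ _)) (cong₂ (adj G) (inverseˡ φ) (inverseˡ φ))

  IsAut-∘ₚ : ∀ {G} φ ψ → IsAut G φ → IsAut G ψ → IsAut G (φ ∘ₚ ψ)
  IsAut-∘ₚ φ ψ autφ autψ = preserves-⟨$⟩ˡ⇒IsAut (φ ∘ₚ ψ) λ x y →
    trans (IsAut⇒preserves-⟨$⟩ˡ φ autφ _ _) (IsAut⇒preserves-⟨$⟩ˡ ψ autψ x y)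

  ≈ᵖ-from-⟨$⟩ˡ : ∀ (φ ψ : Permutation′ n) → (∀ x → φ ⟨$⟩ˡ x ≡ ψ ⟨$⟩ˡ x) → φ ≈ᵖ ψ
  ≈ᵖ-from-⟨$⟩ˡ φ ψ eq i = begin
    φ ⟨$⟩ʳ i                        ≡⟨ inverseʳ ψ ⟨
    ψ ⟨$⟩ʳ (ψ ⟨$⟩ˡ (φ ⟨$⟩ʳ i))      ≡⟨ cong (ψ ⟨$⟩ʳ_) (eq (φ ⟨$⟩ʳ i)) ⟨
    ψ ⟨$⟩ʳ (φ ⟨$⟩ˡ (φ ⟨$⟩ʳ i))      ≡⟨ cong (ψ ⟨$⟩ʳ_) (inverseˡ φ) ⟩
    ψ ⟨$⟩ʳ i                        ∎
    where open ≡-Reasoning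

  ^ˢ-∘ₚ : ∀ (ν : List (Fin n)) φ ψ → ν ^ˢ (φ ∘ₚ ψ) ≡ (ν ^ˢ φ) ^ˢ ψ
  ^ˢ-∘ₚ ν φ ψ = map-∘ ν

  ^ˢ-flip : ∀ (ν : List (Fin n)) φ → (ν ^ˢ φ) ^ˢ flip φ ≡ ν
  ^ˢ-flip ν φ = trans (sym (map-∘ ν)) (trans (map-cong (λ _ → inverseˡ φ) ν) (map-id ν))

  ^ˢ-cong : ∀ (ν : List (Fin n)) {φ ψ} → φ ≈ᵖ ψ → ν ^ˢ φ ≡ ν ^ˢ ψ
  ^ˢ-cong ν φ≈ψ = map-cong φ≈ψ ν

  lookup-^ᶜ : ∀ (c : Col n) φ x → Vec.lookup (c ^ᶜ φ) x ≡ Vec.lookup c (φ ⟨$⟩ˡ x)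
  lookup-^ᶜ c φ x = lookup∘tabulate _ x

  Discrete-^ᶜ : ∀ (c : Col n) φ → Discrete c → Discrete (c ^ᶜ φ)
  Discrete-^ᶜ c φ (bounded , onto) =
    (λ x → subst (ℕ._< n) (sym (lookup-^ᶜ c φ x)) (bounded _)) ,
    λ j j<n → let v , cv≡j = onto j j<n in
      φ ⟨$⟩ʳ v , trans (lookup-^ᶜ c φ _) (trans (cong (Vec.lookup c) (inverseˡ φ)) cv≡j)

  -- The colour classes give an injective, hence surjective, section of c.
  Discrete⇒injective : ∀ (c : Col n) → Discrete c → Injective _≡_ _≡_ (Vec.lookup c)
  Discrete⇒injective c (_ , onto) {x} {y} cx≡cy = begin
    x                  ≡⟨ proj₂ (hit x) ⟨
    section (colour x) ≡⟨ cong section (toℕ-injective (begin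
      toℕ (colour x)                     ≡⟨ colour-section (colour x) ⟨
      Vec.lookup c (section (colour x))  ≡⟨ cong (Vec.lookup c) (proj₂ (hit x)) ⟩
      Vec.lookup c x                     ≡⟨ cx≡cy ⟩
      Vec.lookup c y                     ≡⟨ cong (Vec.lookup c) (proj₂ (hit y)) ⟨
      Vec.lookup c (section (colour y))  ≡⟨ colour-section (colour y) ⟩
      toℕ (colour y)                     ∎)) ⟩
    section (colour y) ≡⟨ proj₂ (hit y) ⟩
    y                  ∎
    where
    section : Fin n → Fin n
    section j = proj₁ (onto (toℕ j) (toℕ<n j))
    colour-section : ∀ j → Vec.lookup c (section j) ≡ toℕ j
    colour-section j = proj₂ (onto (toℕ j) (toℕ<n j))
    section-injective : Injective _≡_ _≡_ section
    section-injective {a} {b} eq =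
      toℕ-injective (trans (sym (colour-section a)) (trans (cong (Vec.lookup c) eq) (colour-section b)))
    hit : StrictlySurjective _≡_ section
    hit = injective⇒strictlySurjective section-injective
    colour : Fin n → Fin n
    colour v = proj₁ (hit v)
    open ≡-Reasoning

  ∈-^ᵛ : ∀ {T : Subset n} {v} φ → v ∈ T → (φ ⟨$⟩ʳ v) ∈ (T ^ᵛ φ)
  ∈-^ᵛ {T} φ v∈T = lookup⇒[]= _ _ (trans (lookup∘tabulate (λ x → Vec.lookup T (φ ⟨$⟩ˡ x)) _)
                                          (trans (cong (Vec.lookup T) (inverseˡ φ)) ([]=⇒lookup v∈T)))

module LeafAction {n : ℕ} (R : Refinement n) (S : CellSelector n) (G : AdjMatrix n) (isGraph : IsGraph G)
  where
  open Refinement R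
  open CellSelector S
  open SearchTree R S G

  Ref-aut : ∀ ν φ → IsAut G φ → Ref G (ν ^ˢ φ) ≡ Ref G ν ^ᶜ φ
  Ref-aut ν φ aut =
    subst (λ H → Ref H (ν ^ˢ φ) ≡ Ref G ν ^ᶜ φ) aut (Refinement.invariant R G ν φ isGraph)

  Sel-aut : ∀ ν φ → IsAut G φ → Sel G (Ref G (ν ^ˢ φ)) ≡ Sel G (Ref G ν) ^ᵛ φ
  Sel-aut ν φ aut = trans (cong (Sel G) (Ref-aut ν φ aut))
    (subst (λ H → Sel H (Ref G ν ^ᶜ φ) ≡ Sel G (Ref G ν) ^ᵛ φ) aut
      (CellSelector.invariant S G (Ref G ν) φ isGraph (isColoring G ν isGraph)))

  Node-^ˢ : ∀ {ν} φ → IsAut G φ → Node ν → Node (ν ^ˢ φ)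
  Node-^ˢ φ aut root = root
  Node-^ˢ φ aut (child {ν} v node v∈Sel) =
    subst Node (sym (map-++ (φ ⟨$⟩ʳ_) ν (v ∷ [])))
      (child (φ ⟨$⟩ʳ v) (Node-^ˢ φ aut node)
        (subst ((φ ⟨$⟩ʳ v) ∈_) (sym (Sel-aut ν φ aut)) (∈-^ᵛ φ v∈Sel)))

  Leaf-^ˢ : ∀ {ν} φ → Leaf ν → IsAut G φ → Leaf (ν ^ˢ φ)
  Leaf-^ˢ {ν} φ (node , discrete) aut =
    Node-^ˢ φ aut node , subst Discrete (sym (Ref-aut ν φ aut)) (Discrete-^ᶜ (Ref G ν) φ discrete)

  Leaf-stabilizer-trivial : ∀ {ν} φ ψ → Leaf ν → IsAut G φ → IsAut G ψ →
                            ν ^ˢ φ ≡ ν ^ˢ ψ → φ ≈ᵖ ψ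
  Leaf-stabilizer-trivial {ν} φ ψ (_ , discrete) autφ autψ eq =
    ≈ᵖ-from-⟨$⟩ˡ φ ψ λ x → Discrete⇒injective (Ref G ν) discrete (begin
      Vec.lookup (Ref G ν) (φ ⟨$⟩ˡ x)  ≡⟨ lookup-^ᶜ (Ref G ν) φ x ⟨
      Vec.lookup (Ref G ν ^ᶜ φ) x      ≡⟨ cong (λ c → Vec.lookup c x) colourings-agree ⟩
      Vec.lookup (Ref G ν ^ᶜ ψ) x      ≡⟨ lookup-^ᶜ (Ref G ν) ψ x ⟩
      Vec.lookup (Ref G ν) (ψ ⟨$⟩ˡ x)  ∎)
    where
    open ≡-Reasoning
    colourings-agree : Ref G ν ^ᶜ φ ≡ Ref G ν ^ᶜ ψ
    colourings-agree = trans (sym (Ref-aut ν φ autφ)) (trans (cong (Ref G) eq) (Ref-aut ν ψ autψ))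

lemma6 : (n : ℕ) (R : Refinement n) (S : CellSelector n) (G : AdjMatrix n) → IsGraph G →
         let open SearchTree R S G in
         (NL NA NQ : ℕ) →
         CountMod Leaf _≡_ NL →
         CountMod (IsAut G) _≈ᵖ_ NA →
         CountMod Leaf (SameOrbit G) NQ →
         NQ * NA ≡ NL
lemma6 _ R S G isGraph _ _ _ =
  FreeAction.|P/Γ|*|Γ|≡|P| Leaf (IsAut G) _≈ᵖ_ _^ˢ_ _∘ₚ_ flip
    (λ φ≈ψ i → sym (φ≈ψ i)) ^ˢ-cong ^ˢ-∘ₚ ^ˢ-flip
    IsAut-∘ₚ IsAut-flip Leaf-^ˢ Leaf-stabilizer-trivial
  where
  open SearchTree R S G
  open LeafAction R S G isGraph
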